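{- Let $w$ be a word of length $n$ over a totally ordered alphabet, let $\overline{w}=u_1u_2\cdots u_n$ be the unique non-decreasing word in $R(w)$, and let $b_1<b_2<\cdots<b_k$ be the indices $i\in\{1,\dots,n-1\}$ with $u_i<u_{i+1}$ (so $u_1=\cdots=u_{b_1}<u_{b_1+1}=\cdots=u_{b_2}<\cdots<u_{b_k+1}=\cdots=u_n$). Then a permutation $\pi\in\mathcal{S}_n$ belongs to $\mathcal{S}_{R(w)}$ if and only if $Id(\pi)\subseteq\{b_1,\dots,b_k\}$.
   Context: $R(w)$ is the set of words obtained by permuting the letters of $w$. The coding $c(v)\in\mathcal{S}_n$ of a word $v=v_1\cdots v_n$ is the unique permutation with $c(v)_i<c(v)_j$ iff $v_i<v_j$, or $v_i=v_j$ and $i<j$. $\mathcal{S}_{R(w)}=\{c(v): v\in R(w)\}\subseteq\mathcal{S}_n$. For $\pi\in\mathcal{S}_n$, $Id(\pi)=\{k: 1\le k<n,\ k+1 \text{ appears to the left of } k\text{ in }\pi\}$. -}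

module Defs where

open import Level using (Level)
open import Data.Nat using (ℕ; _+_)
open import Data.Fin using (Fin; toℕ) renaming (_<_ to _<ᶠ_)
open import Data.Fin.Permutation using (Permutation′; _⟨$⟩ʳ_; _⟨$⟩ˡ_)
open import Data.Product using (Σ; ∃; _×_; _,_)
open import Data.Sum using (_⊎_)
open import Function.Bundles using (_⇔_)
open import Relation.Binary.PropositionalEquality using (_≡_)

-- A word of length n over alphabet A (positions 0..n-1, i.e. paper's 1..n shifted).
Word : ∀ {a} → Set a → ℕ → Set a
Word A n = Fin n → A

-- A permutation of S_n, in one-line notation π_i = π ⟨$⟩ʳ i (values 0..n-1 for paper's 1..n).
Perm : ℕ → Set
Perm n = Permutation′ n

module _ {a ℓ} {A : Set a} (_<_ : A → A → Set ℓ) where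

  InR : ∀ {n} → Word A n → Word A n → Set a
  InR {n} w v = Σ (Perm n) λ σ → ∀ i → v i ≡ w (σ ⟨$⟩ʳ i)

  IsCoding : ∀ {n} → Word A n → Perm n → Set (a Level.⊔ ℓ)
  IsCoding {n} v π = ∀ (i j : Fin n) →
    ((π ⟨$⟩ʳ i) <ᶠ (π ⟨$⟩ʳ j)) ⇔ ((v i < v j) ⊎ ((v i ≡ v j) × (i <ᶠ j)))

  InSR : ∀ {n} → Word A n → Perm n → Set (a Level.⊔ ℓ)
  InSR {n} w π = Σ (Word A n) λ v → InR w v × IsCoding v π

  NonDecreasing : ∀ {n} → Word A n → Set (a Level.⊔ ℓ)
  NonDecreasing {n} u = ∀ (i j : Fin n) → i <ᶠ j → (u i < u j) ⊎ (u i ≡ u j)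

  -- k ∈ {b_1,…,b_k} (1-based k, 1 ≤ k ≤ n-1): u_k < u_{k+1}.
  -- Paper's positions k and k+1 are 0-based positions i, j with toℕ i + 1 ≡ k, toℕ j ≡ k.
  Ascent : ∀ {n} → Word A n → ℕ → Set ℓ
  Ascent {n} u k = Σ (Fin n) λ i → Σ (Fin n) λ j →
    (toℕ i + 1 ≡ k) × (toℕ j ≡ k) × (u i < u j)

-- k ∈ Id(π) (1-based k, 1 ≤ k < n): the value k+1 appears to the left of the value k in π.
-- Paper's values k, k+1 are the Fin values x, y with toℕ x + 1 ≡ k, toℕ y ≡ k;
-- the position of value x in π is π ⟨$⟩ˡ x.
InId : ∀ {n} → Perm n → ℕ → Set
InId {n} π k = Σ (Fin n) λ x → Σ (Fin n) λ y →
  (toℕ x + 1 ≡ k) × (toℕ y ≡ k) × ((π ⟨$⟩ˡ y) <ᶠ (π ⟨$⟩ˡ x))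

-- If π = c(v) with v ∈ R(w), then v ∘ π⁻¹ is a non-decreasing rearrangement of w, hence equal
-- to u: sorted rearrangements are unique, since an injection ρ of Fin n has, below every x, a
-- pivot j with x ≤ ρ j. As a coding breaks ties by position, a descent k of π⁻¹ (that is,
-- k ∈ Id(π)) then forces u_k < u_{k+1}. Conversely, when Id(π) lies inside the ascents of u,
-- π⁻¹ increases across every non-ascent and therefore along every plateau of u, which is exactly
-- what makes π the coding of u ∘ π.

module Submission where

open import Defs
open import Data.Nat using (ℕ)
open import Data.Product using (_×_)
open import Function.Bundles using (_⇔_)
open import Relation.Binary.Structures using (IsStrictTotalOrder)
open import Relation.Binary.PropositionalEquality using (_≡_)

open import Data.Nat.Base as ℕ using (zero; suc; _+_)
import Data.Nat.Properties as ℕ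
open import Data.Fin.Base as Fin using (Fin; toℕ; inject₁)
  renaming (_≤_ to _≤ᶠ_; _<_ to _<ᶠ_)
open import Data.Fin.Properties
  using ( toℕ-injective; toℕ-inject₁; ≤-refl; <-cmp; <-asym; <-irrefl; <⇒≢
        ; injective⇒existsPivot )
  renaming (<-trans to <ᶠ-trans)
open import Data.Fin.Induction using (<-weakInduction-startingFrom)
open import Data.Fin.Permutation using (_⟨$⟩ʳ_; _⟨$⟩ˡ_; inverseˡ; inverseʳ; flip; _∘ₚ_)
open import Data.Product using (_,_)
open import Data.Sum as Sum using (_⊎_; inj₁; inj₂)
open import Function.Bundles using (Injection; mk⇔; module Equivalence)
open import Function.Definitions using (Injective)
open import Function.Properties.Inverse using (↔⇒↣)
open import Relation.Binary.Core using (Rel)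
open import Relation.Binary.Definitions using (Transitive; tri<; tri≈; tri>)
open import Relation.Binary.Structures using (IsStrictPartialOrder)
open import Relation.Binary.PropositionalEquality using (refl; sym; trans; cong; subst; subst₂)
open import Relation.Nullary using (¬_; contradiction)

⟨$⟩ʳ-injective : ∀ {n} (π : Perm n) → Injective _≡_ _≡_ (π ⟨$⟩ʳ_)
⟨$⟩ʳ-injective π = Injection.injective (↔⇒↣ π)

⟨$⟩ˡ-injective : ∀ {n} (π : Perm n) → Injective _≡_ _≡_ (π ⟨$⟩ˡ_)
⟨$⟩ˡ-injective π = ⟨$⟩ʳ-injective (flip π)

adjacent⇒< : ∀ {n} {z z' : Fin n} → toℕ z + 1 ≡ toℕ z' → z <ᶠ z'
adjacent⇒< {z = z} z+1≡z' = ℕ.≤-reflexive (trans (ℕ.+-comm 1 (toℕ z)) z+1≡z')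

adjacent-chain : ∀ {n ℓ} (_∼_ : Rel (Fin n) ℓ) → Transitive _∼_ → ∀ {x y} →
  (∀ {z z'} → toℕ z + 1 ≡ toℕ z' → x ≤ᶠ z → z' ≤ᶠ y → z ∼ z') → x <ᶠ y → x ∼ y
adjacent-chain {zero} _ _ {()}
adjacent-chain {suc n} _∼_ ∼-trans {x} {y} step x<y =
  <-weakInduction-startingFrom P (λ _ x<x → contradiction x<x (<-irrefl refl))
    extend (ℕ.<⇒≤ x<y) ≤-refl x<y
  where
  P : Fin (suc n) → Set _
  P j = j ≤ᶠ y → x <ᶠ j → x ∼ j

  inject₁-adjacent : ∀ j → toℕ (inject₁ j) + 1 ≡ toℕ (Fin.suc j)
  inject₁-adjacent j = trans (cong (_+ 1) (toℕ-inject₁ j)) (ℕ.+-comm (toℕ j) 1)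

  extend : ∀ j → P (inject₁ j) → P (Fin.suc j)
  extend j ih j+1≤y x<j+1 with ℕ.m≤n⇒m<n∨m≡n x≤j
    where
    x≤j : x ≤ᶠ inject₁ j
    x≤j = subst (toℕ x ℕ.≤_) (sym (toℕ-inject₁ j)) (ℕ.s≤s⁻¹ x<j+1)
  ... | inj₁ x<j =
    ∼-trans (ih j≤y x<j) (step (inject₁-adjacent j) (ℕ.<⇒≤ x<j) j+1≤y)
    where
    j≤y : inject₁ j ≤ᶠ y
    j≤y = subst (ℕ._≤ toℕ y) (sym (toℕ-inject₁ j)) (ℕ.<⇒≤ j+1≤y)
  ... | inj₂ x≡j = subst (_∼ Fin.suc j) (sym (toℕ-injective x≡j))
                     (step (inject₁-adjacent j) (ℕ.≤-reflexive x≡j) j+1≤y)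

module Words {a ℓ} {A : Set a} (_<_ : Rel A ℓ) where

  Id⊆Ascents : ∀ {n} → Perm n → Word A n → Set ℓ
  Id⊆Ascents π u = ∀ k → InId π k → Ascent _<_ u k

  InR-sym : ∀ {n} {w v : Word A n} → InR _<_ w v → InR _<_ v w
  InR-sym {w = w} (σ , v≗wσ) =
    flip σ , λ i → trans (cong w (sym (inverseʳ σ))) (sym (v≗wσ (σ ⟨$⟩ˡ i)))

  InR-trans : ∀ {n} {u v w : Word A n} → InR _<_ u v → InR _<_ v w → InR _<_ u w
  InR-trans (σ , v≗uσ) (τ , w≗vτ) = τ ∘ₚ σ , λ i → trans (w≗vτ i) (v≗uσ (τ ⟨$⟩ʳ i))

  InR-reindex : ∀ {n} (w : Word A n) (σ : Perm n) → InR _<_ w (λ i → w (σ ⟨$⟩ʳ i))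
  InR-reindex _ σ = σ , λ _ → refl

  coding-on-values : ∀ {n} {v : Word A n} {π : Perm n} → IsCoding _<_ v π →
    ∀ {x y} → x <ᶠ y →
    v (π ⟨$⟩ˡ x) < v (π ⟨$⟩ˡ y) ⊎ (v (π ⟨$⟩ˡ x) ≡ v (π ⟨$⟩ˡ y) × π ⟨$⟩ˡ x <ᶠ π ⟨$⟩ˡ y)
  coding-on-values {π = π} cod {x} {y} x<y =
    Equivalence.to (cod (π ⟨$⟩ˡ x) (π ⟨$⟩ˡ y))
      (subst₂ _<ᶠ_ (sym (inverseʳ π)) (sym (inverseʳ π)) x<y)

  coding-sorts : ∀ {n} {v : Word A n} {π : Perm n} → IsCoding _<_ v π →
    NonDecreasing _<_ (λ x → v (π ⟨$⟩ˡ x))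
  coding-sorts {π = π} cod _ _ x<y =
    Sum.map₂ (λ (eq , _) → eq) (coding-on-values {π = π} cod x<y)

  coding-inversion : ∀ {n} {v : Word A n} {π : Perm n} → IsCoding _<_ v π → ∀ {x y} →
    x <ᶠ y → π ⟨$⟩ˡ y <ᶠ π ⟨$⟩ˡ x → v (π ⟨$⟩ˡ x) < v (π ⟨$⟩ˡ y)
  coding-inversion {π = π} cod x<y inv with coding-on-values {π = π} cod x<y
  ... | inj₁ lt = lt
  ... | inj₂ (_ , ord) = contradiction ord (<-asym inv)

  ascent-adjacent : ∀ {n} {u : Word A n} {z z'} → toℕ z + 1 ≡ toℕ z' →
    Ascent _<_ u (toℕ z') → u z < u z'
  ascent-adjacent {u = u} {z} {z'} z+1≡z' (i , j , i+1≡k , j≡k , ui<uj) =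
    subst₂ (λ p q → u p < u q) i≡z j≡z' ui<uj
    where
    i≡z : i ≡ z
    i≡z = toℕ-injective (ℕ.+-cancelʳ-≡ 1 _ _ (trans i+1≡k (sym z+1≡z')))
    j≡z' : j ≡ z'
    j≡z' = toℕ-injective j≡k

  non-ascent⇒ordered : ∀ {n} {π : Perm n} {u : Word A n} → Id⊆Ascents π u →
    ∀ {z z'} → toℕ z + 1 ≡ toℕ z' → ¬ (u z < u z') → π ⟨$⟩ˡ z <ᶠ π ⟨$⟩ˡ z'
  non-ascent⇒ordered {π = π} Id⊆A {z} {z'} adj ¬uz<uz'
    with <-cmp (π ⟨$⟩ˡ z) (π ⟨$⟩ˡ z')
  ... | tri< lt _ _ = lt
  ... | tri≈ _ eq _ = contradiction (⟨$⟩ˡ-injective π eq) (<⇒≢ (adjacent⇒< adj))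
  ... | tri> _ _ gt =
    contradiction (ascent-adjacent adj (Id⊆A _ (z , z' , adj , refl , gt))) ¬uz<uz'

module _ {a ℓ} {A : Set a} {_<_ : Rel A ℓ} (spo : IsStrictPartialOrder _≡_ _<_) where
  open Words _<_
  open IsStrictPartialOrder spo
    using (irrefl; <-respʳ-≈; <-respˡ-≈) renaming (trans to <-trans)
  open import Relation.Binary.Construct.StrictToNonStrict _≡_ _<_ as NonStrict using (_≤_)

  private
    <-≤-trans : ∀ {x y z} → x < y → y ≤ z → x < z
    <-≤-trans = NonStrict.<-≤-trans <-trans <-respʳ-≈

    ≤-<-trans : ∀ {x y z} → x ≤ y → y < z → x < z
    ≤-<-trans = NonStrict.≤-<-trans sym <-trans <-respˡ-≈

  nonDecreasing⇒monotone : ∀ {n} {u : Word A n} → NonDecreasing _<_ u →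
    ∀ {i j} → i ≤ᶠ j → u i ≤ u j
  nonDecreasing⇒monotone {u = u} u↑ {i} {j} i≤j with ℕ.m≤n⇒m<n∨m≡n i≤j
  ... | inj₁ i<j = u↑ i j i<j
  ... | inj₂ i≡j = inj₂ (cong u (toℕ-injective i≡j))

  sorted-rearrangement-≯ : ∀ {n} {u v : Word A n} →
    NonDecreasing _<_ u → NonDecreasing _<_ v → InR _<_ u v → ∀ x → ¬ (v x < u x)
  sorted-rearrangement-≯ {u = u} {v} u↑ v↑ (ρ , v≗uρ) x vx<ux
    with j , j≤x , x≤ρj ← injective⇒existsPivot (⟨$⟩ʳ-injective ρ) x =
    irrefl refl (≤-<-trans (nonDecreasing⇒monotone v↑ j≤x) (<-≤-trans vx<ux ux≤vj))
    where
    ux≤vj : u x ≤ v j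
    ux≤vj = subst (u x ≤_) (sym (v≗uρ j)) (nonDecreasing⇒monotone u↑ x≤ρj)

  sorted-coding : ∀ {n} {u : Word A n} {π : Perm n} → NonDecreasing _<_ u →
    (∀ {x y} → x <ᶠ y → u x ≡ u y → π ⟨$⟩ˡ x <ᶠ π ⟨$⟩ˡ y) →
    IsCoding _<_ (λ i → u (π ⟨$⟩ʳ i)) π
  sorted-coding {u = u} {π} u↑ ties i j = mk⇔ to from
    where
    to : π ⟨$⟩ʳ i <ᶠ π ⟨$⟩ʳ j →
      u (π ⟨$⟩ʳ i) < u (π ⟨$⟩ʳ j) ⊎ (u (π ⟨$⟩ʳ i) ≡ u (π ⟨$⟩ʳ j) × i <ᶠ j)
    to πi<πj = Sum.map₂ (λ eq → eq , subst₂ _<ᶠ_ (inverseˡ π) (inverseˡ π) (ties πi<πj eq))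
                        (u↑ _ _ πi<πj)
    from : u (π ⟨$⟩ʳ i) < u (π ⟨$⟩ʳ j) ⊎ (u (π ⟨$⟩ʳ i) ≡ u (π ⟨$⟩ʳ j) × i <ᶠ j) →
      π ⟨$⟩ʳ i <ᶠ π ⟨$⟩ʳ j
    from s with <-cmp (π ⟨$⟩ʳ i) (π ⟨$⟩ʳ j) | s
    ... | tri< lt _ _ | _ = lt
    ... | tri≈ _ eq _ | inj₁ lt = contradiction lt (irrefl (cong u eq))
    ... | tri≈ _ eq _ | inj₂ (_ , i<j) = contradiction (⟨$⟩ʳ-injective π eq) (<⇒≢ i<j)
    ... | tri> _ _ gt | inj₁ lt = contradiction (≤-<-trans (u↑ _ _ gt) lt) (irrefl refl)
    ... | tri> _ _ gt | inj₂ (eq , i<j) =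
      contradiction i<j (<-asym (subst₂ _<ᶠ_ (inverseˡ π) (inverseˡ π) (ties gt (sym eq))))

  Id⊆Ascents⇒ties-ordered : ∀ {n} {π : Perm n} {u : Word A n} → NonDecreasing _<_ u →
    Id⊆Ascents π u → ∀ {x y} → x <ᶠ y → u x ≡ u y → π ⟨$⟩ˡ x <ᶠ π ⟨$⟩ˡ y
  Id⊆Ascents⇒ties-ordered {π = π} {u} u↑ Id⊆A {x} {y} x<y ux≡uy =
    adjacent-chain (λ p q → π ⟨$⟩ˡ p <ᶠ π ⟨$⟩ˡ q) <ᶠ-trans plateau x<y
    where
    plateau : ∀ {z z'} → toℕ z + 1 ≡ toℕ z' → x ≤ᶠ z → z' ≤ᶠ y → π ⟨$⟩ˡ z <ᶠ π ⟨$⟩ˡ z'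
    plateau {z} {z'} adj x≤z z'≤y = non-ascent⇒ordered {π = π} {u} Id⊆A adj λ uz<uz' →
      irrefl refl (≤-<-trans (nonDecreasing⇒monotone u↑ x≤z) (<-≤-trans uz<uz'
        (subst (u z' ≤_) (sym ux≡uy) (nonDecreasing⇒monotone u↑ z'≤y))))

  Id⊆Ascents⇒InSR : ∀ {n} {w u : Word A n} {π : Perm n} →
    InR _<_ w u → NonDecreasing _<_ u → Id⊆Ascents π u → InSR _<_ w π
  Id⊆Ascents⇒InSR {w = w} {u} {π} w↝u u↑ Id⊆A =
    (λ i → u (π ⟨$⟩ʳ i)) , InR-trans {u = w} w↝u (InR-reindex u π) ,
    sorted-coding {u = u} {π} u↑ (Id⊆Ascents⇒ties-ordered {π = π} u↑ Id⊆A)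

module _ {a ℓ} {A : Set a} {_<_ : Rel A ℓ} (sto : IsStrictTotalOrder _≡_ _<_) where
  open IsStrictTotalOrder sto using (compare) renaming (isStrictPartialOrder to spo)
  open Words _<_

  sorted-rearrangement-unique : ∀ {n} {u v : Word A n} → NonDecreasing _<_ u →
    NonDecreasing _<_ v → InR _<_ u v → ∀ x → u x ≡ v x
  sorted-rearrangement-unique {u = u} {v} u↑ v↑ u↝v x with compare (u x) (v x)
  ... | tri< lt _ _ = contradiction lt (sorted-rearrangement-≯ spo v↑ u↑ (InR-sym u↝v) x)
  ... | tri≈ _ eq _ = eq
  ... | tri> _ _ gt = contradiction gt (sorted-rearrangement-≯ spo u↑ v↑ u↝v x)

  InSR⇒Id⊆Ascents : ∀ {n} {w u : Word A n} {π : Perm n} →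
    InR _<_ w u → NonDecreasing _<_ u → InSR _<_ w π → Id⊆Ascents π u
  InSR⇒Id⊆Ascents {w = w} {u} {π} w↝u u↑ (v , w↝v , cod) _ (x , y , x+1≡k , y≡k , inv) =
    x , y , x+1≡k , y≡k , subst₂ _<_ (sym (u≡vπ⁻¹ x)) (sym (u≡vπ⁻¹ y))
      (coding-inversion {π = π} cod (adjacent⇒< (trans x+1≡k (sym y≡k))) inv)
    where
    u↝w : InR _<_ u w
    u↝w = InR-sym {w = w} w↝u
    w↝vπ⁻¹ : InR _<_ w (λ z → v (π ⟨$⟩ˡ z))
    w↝vπ⁻¹ = InR-trans {u = w} w↝v (InR-reindex v (flip π))
    u≡vπ⁻¹ : ∀ z → u z ≡ v (π ⟨$⟩ˡ z)
    u≡vπ⁻¹ = sorted-rearrangement-unique u↑ (coding-sorts {π = π} cod)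
      (InR-trans {u = u} u↝w w↝vπ⁻¹)

proposition2p4 : ∀ {a ℓ} {A : Set a} (_<_ : A → A → Set ℓ)
    → IsStrictTotalOrder _≡_ _<_
    → (n : ℕ) (w u : Word A n)
    → InR _<_ w u → NonDecreasing _<_ u
    → (π : Perm n)
    → InSR _<_ w π ⇔ (∀ (k : ℕ) → InId π k → Ascent _<_ u k)
proposition2p4 _<_ sto n w u w↝u u↑ π =
  mk⇔ (InSR⇒Id⊆Ascents sto {w = w} {u} {π} w↝u u↑)
      (Id⊆Ascents⇒InSR isStrictPartialOrder {w = w} {u} {π} w↝u u↑)
  where open IsStrictTotalOrder sto using (isStrictPartialOrder)
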